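{- Let $A$ be a regular system of divisors and let $\mathcal{E}_A=\bigcup_{r\in\mathbb{N}}\mathcal{E}_{A,r}\subseteq\mathbb{C}^{\mathbb{N}}$. Then $\mathcal{E}_A$ is a vector space over $\mathbb{C}$ (under pointwise addition and scalar multiplication) if and only if $A=D$, where $D(n)$ is the set of all positive divisors of $n$.
   Context: For each $n\in\mathbb{N}$ let $A(n)$ be a subset of the set of positive divisors of $n$, and define the $A$-convolution of $f,g:\mathbb{N}\to\mathbb{C}$ by $(f*_Ag)(n)=\sum_{d\in A(n)}f(d)g(n/d)$. The system $A=(A(n))_{n\in\mathbb{N}}$ is called regular if (a) $(\mathbb{C}^{\mathbb{N}},+,*_A)$ is a commutative ring with unity; (b) the $A$-convolution of multiplicative functions is multiplicative; (c) the constant function $1$ has an inverse $\mu_A$ with respect to $*_A$, and $\mu_A(p^a)\in\{ -1,0\}$ for every prime power $p^a$, $a\ge1$. Equivalently, $A$ is regular iff (i) $A(mn)=\{de: d\in A(m), e\in A(n)\}$ whenever $\gcd(m,n)=1$, and (ii) for every prime power $p^a$ ($a\ge1$) there is a divisor $t=t_A(p^a)$ of $a$ such that $A(p^{it})=\{1,p^t,\dots,p^{it}\}$ for every $i\in\{0,1,\dots,a/t\}$. For $k,r\in\mathbb{N}$ let $(k,r)_A=\max\{d\in\mathbb{N}: d\mid k,\ d\in A(r)\}$. For $r\in\mathbb{N}$, $\mathcal{E}_{A,r}$ denotes the set of functions $f:\mathbb{N}\to\mathbb{C}$ that are $A$-even modulo $r$, i.e. $f(n)=f((n,r)_A)$ for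 every $n\in\mathbb{N}$. -}

module Defs where

open import Level using (Level; _⊔_) renaming (suc to lsuc)
open import Data.Nat using (ℕ; _^_; _≤_) renaming (_*_ to _*ℕ_)
open import Data.Nat.Divisibility using (_∣_)
open import Data.Nat.Coprimality using (Coprime)
open import Data.Nat.Primality using (Prime)
open import Data.Product using (_×_; ∃; ∃₂)
open import Relation.Nullary using (¬_)
open import Relation.Binary.PropositionalEquality using (_≡_)
open import Function.Bundles using (_⇔_)
open import Algebra.Bundles using (CommutativeRing)
import Algebra.Definitions.RawMonoid as RawMonoidDefs

-- A field (stdlib has no Field bundle): a commutative ring with 0 ≠ 1 in
-- which every nonzero element is invertible.  We additionally require
-- characteristic zero (as for ℂ).
record Field (c ℓ : Level) : Set (lsuc (c ⊔ ℓ)) where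
  field
    commutativeRing : CommutativeRing c ℓ
  open CommutativeRing commutativeRing public
  open RawMonoidDefs +-rawMonoid public using () renaming (_×_ to _·ℕ_)
  field
    0≉1      : ¬ (0# ≈ 1#)
    inverse  : ∀ x → ¬ (x ≈ 0#) → ∃ λ y → x * y ≈ 1#
    charZero : ∀ n → (n ·ℕ 1#) ≈ 0# → n ≡ 0

-- A system of divisors: A n d  means  d ∈ A(n).  Only n ≥ 1 is relevant.
DivSystem : Set₁
DivSystem = ℕ → ℕ → Set

-- Regularity, via the characterisation (i), (ii) of the paper.
record IsRegular (A : DivSystem) : Set where
  field
    subset   : ∀ n d → 1 ≤ n → A n d → d ∣ n
    multiplicative : ∀ m n → 1 ≤ m → 1 ≤ n → Coprime m n → ∀ d →
                     A (m *ℕ n) d ⇔ (∃₂ λ d₁ d₂ → A m d₁ × A n d₂ × d ≡ d₁ *ℕ d₂)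
    primePower : ∀ p a → Prime p → 1 ≤ a →
                 ∃₂ λ t q → a ≡ q *ℕ t ×
                   (∀ i → i ≤ q → ∀ d →
                     A (p ^ (i *ℕ t)) d ⇔ (∃ λ j → j ≤ i × d ≡ p ^ (j *ℕ t)))

IsAGcd : DivSystem → ℕ → ℕ → ℕ → Set
IsAGcd A k r d = d ∣ k × A r d × (∀ e → e ∣ k → A r e → e ≤ d)

IsAllDivisors : DivSystem → Set
IsAllDivisors A = ∀ n d → 1 ≤ n → (A n d ⇔ d ∣ n)

module _ {c ℓ : Level} (K : Field c ℓ) where
  open Field K

  AEven : DivSystem → ℕ → (ℕ → Carrier) → Set ℓ
  AEven A r f = ∀ n d → 1 ≤ n → IsAGcd A n r d → f n ≈ f d

  InEA : DivSystem → (ℕ → Carrier) → Set ℓ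
  InEA A f = ∃ λ r → 1 ≤ r × AEven A r f

  -- 𝓔_A is a vector space under pointwise operations, i.e. a linear
  -- subspace of K^ℕ: contains 0, closed under + and scalar multiplication.
  EAIsVectorSpace : DivSystem → Set (c ⊔ ℓ)
  EAIsVectorSpace A =
    InEA A (λ _ → 0#) ×
    (∀ f g → InEA A f → InEA A g → InEA A (λ n → f n + g n)) ×
    (∀ (a : Carrier) f → InEA A f → InEA A (λ n → a * f n))

module Submission where

-- If A = D then (n, r)_A = gcd n r, so a function A-even modulo r is A-even modulo every
-- multiple of r, and 𝓔_A is closed under sums (take the modulus r s).  Conversely, let 𝓔_A be
-- a subspace and suppose p ∉ A(p^a), i.e. t_A(p^a) > 1.  Then h(n) = [p ∣ n] − [p^a ∣ n] is a
-- combination of functions A-even modulo p and modulo p^a, so it is A-even modulo some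
-- r = p^b m with p ∤ m.  If p ∉ A(r), then (p, r)_A = 1 but h(p) = 1 ≠ 0 = h(1).  Otherwise
-- t_A(p^b) = 1, which forces b < a, and then (p^a, r)_A = p^b but h(p^a) = 0 ≠ 1 = h(p^b).
-- So A(p^a) contains every p^k, and A = D by multiplicativity.

open import Defs
open import Level using (Level)
open import Function.Base using (_∘_; id)
open import Function.Bundles using (_⇔_; mk⇔; Equivalence)
open import Data.Nat using (ℕ; zero; suc; _*_; _^_; _≤_; _<_; z≤n; s≤s; z<s; _≟_; _≤?_; >-nonZero; >-nonZero⁻¹; nonTrivial⇒n>1)
open import Data.Nat.Properties
open import Data.Nat.Divisibility
open import Data.Nat.GCD using (gcd; gcd[m,n]∣m; gcd[m,n]∣n; gcd-greatest)
open import Data.Nat.Coprimality using (Coprime; coprime-divisor; 1-coprimeTo) renaming (sym to Coprime-sym)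
open import Data.Nat.Primality
open import Data.Nat.Primality.Factorisation using (factorise)
open import Data.Nat.Induction using (<-rec)
open import Data.Nat.ListAction using (product)
open import Data.List using ([]; _∷_)
open import Data.List.Relation.Unary.All using (_∷_)
open import Data.Product using (_×_; _,_; ∃; ∃₂)
open import Data.Sum using (_⊎_; inj₁; inj₂; [_,_])
open import Data.Empty using (⊥; ⊥-elim)
open import Relation.Nullary using (¬_; Dec; yes; no; contradiction)
open import Relation.Binary.PropositionalEquality using (_≡_; refl; sym; trans; cong; subst; subst₂)

private variable a b d d₁ d₂ e k m n p r R : ℕ

prime⇒1<p : Prime p → 1 < p
prime⇒1<p {p} pr = nonTrivial⇒n>1 p {{prime⇒nonTrivial pr}}

prime⇒0<p : Prime p → 0 < p
prime⇒0<p {p} pr = >-nonZero⁻¹ p {{prime⇒nonZero pr}}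

prime⇒0<p^e : Prime p → ∀ e → 0 < p ^ e
prime⇒0<p^e {p} pr = m^n>0 p {{prime⇒nonZero pr}}

prime⇒∤1 : Prime p → ¬ p ∣ 1
prime⇒∤1 pr p∣1 = ¬prime[1] (subst Prime (∣1⇒≡1 p∣1) pr)

^-monoʳ-∣ : ∀ p → m ≤ n → p ^ m ∣ p ^ n
^-monoʳ-∣ p z≤n     = 1∣ _
^-monoʳ-∣ p (s≤s h) = *-monoʳ-∣ p (^-monoʳ-∣ p h)

m∣m^n : ∀ m → 0 < n → m ∣ m ^ n
m∣m^n {n = suc n} m _ = m∣m*n (m ^ n)

^-cancelʳ-∣ : 1 < p → p ^ m ∣ p ^ n → m ≤ n
^-cancelʳ-∣ {p} {m} {n} 1<p p^m∣p^n = ≮⇒≥ λ n<m →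
  <⇒≱ (^-monoʳ-< p 1<p n<m) (∣⇒≤ {{m^n≢0 p n {{>-nonZero (<-trans z<s 1<p)}}}} p^m∣p^n)

p^n≡p⇒n≡1 : 1 < p → p ^ n ≡ p → n ≡ 1
p^n≡p⇒n≡1 {n = zero}        1<p eq = contradiction eq (<⇒≢ 1<p)
p^n≡p⇒n≡1 {n = suc zero}    _   _  = refl
p^n≡p⇒n≡1 {p} {suc (suc n)} 1<p eq =
  contradiction (trans eq (sym (^-identityʳ p))) (>⇒≢ (^-monoʳ-< p 1<p {1} {suc (suc n)} (s≤s (s≤s z≤n))))

prime∤⇒coprime : Prime p → ¬ p ∣ m → Coprime p m
prime∤⇒coprime pr p∤m (d∣p , d∣m) with prime⇒irreducible pr d∣p
... | inj₁ d≡1    = d≡1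
... | inj₂ refl   = contradiction d∣m p∤m

coprime-*ˡ : ∀ {a b} → Coprime a m → Coprime b m → Coprime (a * b) m
coprime-*ˡ a⊥m b⊥m (d∣ab , d∣m) =
  b⊥m (coprime-divisor (λ (x∣d , x∣a) → a⊥m (x∣a , ∣-trans x∣d d∣m)) d∣ab , d∣m)

coprime-^ˡ : Coprime a m → ∀ e → Coprime (a ^ e) m
coprime-^ˡ {m = m} _   zero    = 1-coprimeTo m
coprime-^ˡ         a⊥m (suc e) = coprime-*ˡ a⊥m (coprime-^ˡ a⊥m e)

prime-split : Prime p → 0 < n → ∃₂ λ e m → n ≡ p ^ e * m × ¬ p ∣ m
prime-split {p} pr = <-rec _ split _
  where
    split : ∀ n → (∀ {k} → k < n → 0 < k → ∃₂ λ e m → k ≡ p ^ e * m × ¬ p ∣ m) →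
            0 < n → ∃₂ λ e m → n ≡ p ^ e * m × ¬ p ∣ m
    split n rec 0<n with p ∣? n
    ... | no p∤n = 0 , n , sym (*-identityˡ n) , p∤n
    ... | yes (divides zero n≡0) = contradiction n≡0 (>⇒≢ 0<n)
    ... | yes (divides k@(suc _) n≡kp) with rec (subst (k <_) (sym n≡kp) (m<m*n k p (prime⇒1<p pr))) z<s
    ...   | e , m , k≡p^em , p∤m = suc e , m , n≡p^[1+e]m , p∤m
      where
        n≡p^[1+e]m : n ≡ p ^ suc e * m
        n≡p^[1+e]m = trans n≡kp (trans (cong (_* p) k≡p^em)
                       (trans (*-comm (p ^ e * m) p) (sym (*-assoc p (p ^ e) m))))

∃prime∣ : 1 < n → ∃ λ p → Prime p × p ∣ n
∃prime∣ {n} 1<n with factorise n {{>-nonZero (<-trans z<s 1<n)}}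
... | record { factors = [] ; isFactorisation = n≡1 } = contradiction n≡1 (>⇒≢ 1<n)
... | record { factors = q ∷ qs ; isFactorisation = n≡q*qs ; factorsPrime = q-prime ∷ _ } =
  q , q-prime , divides (product qs) (trans n≡q*qs (*-comm q (product qs)))

primePower-induction : (Q : ℕ → Set) → Q 1 →
  (∀ {p e m} → Prime p → 0 < e → 0 < m → ¬ p ∣ m → Q m → Q (p ^ e * m)) →
  ∀ n → 0 < n → Q n
primePower-induction Q Q1 step = <-rec _ go
  where
    go : ∀ n → (∀ {k} → k < n → 0 < k → Q k) → 0 < n → Q n
    go (suc zero) _ _ = Q1
    go n@(suc (suc _)) rec _ with ∃prime∣ {n} (s≤s z<s)
    ... | p , pr , p∣n with prime-split pr z<s
    ...   | zero , m , n≡m , p∤m = contradiction (subst (p ∣_) (trans n≡m (*-identityˡ m)) p∣n) p∤m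
    ...   | suc e , zero , n≡0 , _ = contradiction (trans n≡0 (*-zeroʳ (p ^ suc e))) λ ()
    ...   | e@(suc _) , m@(suc _) , n≡p^em , p∤m =
      subst Q (sym n≡p^em) (step {e = e} pr z<s z<s p∤m (rec m<n z<s))
      where
        m<n : m < n
        m<n = subst (m <_) (trans (*-comm m (p ^ e)) (sym n≡p^em))
                (m<m*n m (p ^ e) (^-monoʳ-< p (prime⇒1<p pr) {0} {e} z<s))

p^k*d∣p^e*m⇒k≤e×d∣m : Prime p → ¬ p ∣ m → ¬ p ∣ d → p ^ k * d ∣ p ^ e * m → k ≤ e × d ∣ m
p^k*d∣p^e*m⇒k≤e×d∣m {p} {m} {d} {k} {e} pr p∤m p∤d p^kd∣p^em =
  ^-cancelʳ-∣ (prime⇒1<p pr) (coprime-divisor (coprime-^ˡ (prime∤⇒coprime pr p∤m) k) p^k∣m*p^e) ,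
  coprime-divisor (Coprime-sym (coprime-^ˡ (prime∤⇒coprime pr p∤d) e)) (∣-trans (n∣m*n (p ^ k)) p^kd∣p^em)
  where
    p^k∣m*p^e : p ^ k ∣ m * p ^ e
    p^k∣m*p^e = subst (p ^ k ∣_) (*-comm (p ^ e) m) (∣-trans (m∣m*n d) p^kd∣p^em)

d∣n⇒0<d : 0 < n → d ∣ n → 0 < d
d∣n⇒0<d {d = zero} 0<n 0∣n = contradiction (0∣⇒≡0 0∣n) (>⇒≢ 0<n)
d∣n⇒0<d {d = suc _} _ _ = z<s

gcd[gcd[n,m],d]≡gcd[n,d] : d ∣ m → gcd (gcd n m) d ≡ gcd n d
gcd[gcd[n,m],d]≡gcd[n,d] {d = d} {m = m} {n = n} d∣m = ∣-antisym
  (gcd-greatest (∣-trans (gcd[m,n]∣m (gcd n m) d) (gcd[m,n]∣m n m)) (gcd[m,n]∣n (gcd n m) d))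
  (gcd-greatest (gcd-greatest (gcd[m,n]∣m n d) (∣-trans (gcd[m,n]∣n n d) d∣m)) (gcd[m,n]∣n n d))

module Regular {A : DivSystem} (reg : IsRegular A) where
  open IsRegular reg
  open Equivalence using (to; from)

  A-* : Coprime m n → 0 < m → 0 < n → A m d₁ → A n d₂ → A (m * n) (d₁ * d₂)
  A-* m⊥n 0<m 0<n d₁∈A[m] d₂∈A[n] =
    from (multiplicative _ _ 0<m 0<n m⊥n _) (_ , _ , d₁∈A[m] , d₂∈A[n] , refl)

  1∈A[1] : A 1 1
  1∈A[1] with primePower 2 1 prime[2] z<s
  ... | _ , _ , _ , A[2^[it]] = from (A[2^[it]] 0 z≤n 1) (0 , z≤n , refl)

  1∈A[p^a] : ∀ {a} → Prime p → 0 < a → A (p ^ a) 1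
  1∈A[p^a] {p} {a} pr 0<a with primePower p a pr 0<a
  ... | t , q , a≡qt , A[p^[it]] =
    subst (λ x → A (p ^ x) 1) (sym a≡qt) (from (A[p^[it]] q ≤-refl 1) (0 , z≤n , refl))

  p^a∈A[p^a] : ∀ {a} → Prime p → 0 < a → A (p ^ a) (p ^ a)
  p^a∈A[p^a] {p} {a} pr 0<a with primePower p a pr 0<a
  ... | t , q , a≡qt , A[p^[it]] =
    subst (λ x → A (p ^ x) (p ^ x)) (sym a≡qt) (from (A[p^[it]] q ≤-refl _) (q , ≤-refl , refl))

  p∈A[p] : Prime p → A p p
  p∈A[p] {p} pr = subst₂ A (^-identityʳ p) (^-identityʳ p) (p^a∈A[p^a] {a = 1} pr z<s)

  A-*-primePower : Prime p → ¬ p ∣ m → 0 < m → A (p ^ e) d₁ → A m d₂ → A (p ^ e * m) (d₁ * d₂)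
  A-*-primePower {p} {e = e} pr p∤m =
    A-* (coprime-^ˡ (prime∤⇒coprime pr p∤m) e) (prime⇒0<p^e pr e)

  1∈A[n] : 0 < n → A n 1
  1∈A[n] {n} = primePower-induction (λ n → A n 1) 1∈A[1]
    (λ {e = e} pr 0<e 0<m p∤m 1∈A[m] → A-*-primePower {e = e} pr p∤m 0<m (1∈A[p^a] pr 0<e) 1∈A[m]) n

  p^e∈A[p^e*m] : Prime p → ¬ p ∣ m → 0 < e → 0 < m → A (p ^ e * m) (p ^ e)
  p^e∈A[p^e*m] {p} {e = e} pr p∤m 0<e 0<m =
    subst (A _) (*-identityʳ (p ^ e)) (A-*-primePower {e = e} pr p∤m 0<m (p^a∈A[p^a] pr 0<e) (1∈A[n] 0<m))

  p∈A[p^e*m]⇒p∈A[p^e] : Prime p → ¬ p ∣ m → 0 < m → A (p ^ e * m) p → A (p ^ e) p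
  p∈A[p^e*m]⇒p∈A[p^e] {p} {e = e} pr p∤m 0<m p∈A[p^em]
    with to (multiplicative _ _ (prime⇒0<p^e pr e) 0<m (coprime-^ˡ (prime∤⇒coprime pr p∤m) e) p) p∈A[p^em]
  ... | d₁ , d₂ , d₁∈A[p^e] , d₂∈A[m] , p≡d₁d₂ with prime⇒irreducible pr (divides d₁ p≡d₁d₂)
  ...   | inj₁ refl = subst (A _) (sym (trans p≡d₁d₂ (*-identityʳ d₁))) d₁∈A[p^e]
  ...   | inj₂ refl = contradiction (subset _ _ 0<m d₂∈A[m]) p∤m

  -- According as t_A(p^a) = 1 or not.
  primePower-dichotomy : Prime p → ∀ a →
    (∀ {i k} → k ≤ i → i ≤ a → A (p ^ i) (p ^ k)) ⊎ ¬ A (p ^ a) p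
  primePower-dichotomy pr zero = inj₁ λ { z≤n z≤n → 1∈A[1] }
  primePower-dichotomy {p} pr a@(suc _) with primePower p a pr z<s
  ... | t , q , a≡qt , A[p^[it]] with t ≟ 1
  ...   | yes refl = inj₁ λ {i} {k} k≤i i≤a →
    subst₂ (λ x y → A (p ^ x) (p ^ y)) (*-identityʳ i) (*-identityʳ k)
      (from (A[p^[it]] i (subst (i ≤_) (trans a≡qt (*-identityʳ q)) i≤a) _) (k , k≤i , refl))
  ...   | no t≢1 = inj₂ λ p∈A[p^a] →
    let j , _ , p≡p^jt = to (A[p^[it]] q ≤-refl p) (subst (λ x → A (p ^ x) p) a≡qt p∈A[p^a])
    in t≢1 (m*n≡1⇒n≡1 j t (p^n≡p⇒n≡1 (prime⇒1<p pr) (sym p≡p^jt)))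

IsAGcd-unique : ∀ {A d′} → IsAGcd A n r d → IsAGcd A n r d′ → d ≡ d′
IsAGcd-unique (d∣n , d∈A[r] , d-max) (d′∣n , d′∈A[r] , d′-max) =
  ≤-antisym (d′-max _ d∣n d∈A[r]) (d-max _ d′∣n d′∈A[r])

module _ {c ℓ : Level} (K : Field c ℓ) where
  open Field K using (Carrier; _≈_; 0#; 1#; -_; 0≉1; setoid; reflexive)
    renaming (_+_ to _+ᴷ_; _*_ to _*ᴷ_)
  module K = Field K
  open import Relation.Binary.Reasoning.Setoid setoid

  𝟙 : {P : Set} → Dec P → Carrier
  𝟙 (yes _) = 1#
  𝟙 (no _)  = 0#

  𝟙-cong : {P Q : Set} (P? : Dec P) (Q? : Dec Q) → (P → Q) → (Q → P) → 𝟙 P? ≡ 𝟙 Q?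
  𝟙-cong (yes _) (yes _) _   _   = refl
  𝟙-cong (no _)  (no _)  _   _   = refl
  𝟙-cong (yes P) (no ¬Q) P→Q _   = contradiction (P→Q P) ¬Q
  𝟙-cong (no ¬P) (yes Q) _   Q→P = contradiction (Q→P Q) ¬P

  𝟙-yes : {P : Set} (P? : Dec P) → P → 𝟙 P? ≡ 1#
  𝟙-yes P? P = 𝟙-cong P? (yes P) id id

  𝟙-no : {P : Set} (P? : Dec P) → ¬ P → 𝟙 P? ≡ 0#
  𝟙-no P? ¬P = 𝟙-cong P? (no ¬P) id id

  module _ {A : DivSystem} (reg : IsRegular A) where
    open IsRegular reg
    open Regular reg

    -- (n, r)_A = r exactly when r ∣ n, because (n, r)_A ∣ r and it dominates r whenever r ∣ n.
    𝟙[r∣-]-even : 0 < r → A r r → AEven K A r (λ n → 𝟙 (r ∣? n))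
    𝟙[r∣-]-even {r} 0<r r∈A[r] n d _ (d∣n , d∈A[r] , d-max) =
      reflexive (𝟙-cong (r ∣? n) (r ∣? d) r∣n⇒r∣d (λ r∣d → ∣-trans r∣d d∣n))
      where
        r∣n⇒r∣d : r ∣ n → r ∣ d
        r∣n⇒r∣d r∣n = ∣-reflexive
          (≤-antisym (d-max r r∣n r∈A[r]) (∣⇒≤ {{>-nonZero 0<r}} (subset r d 0<r d∈A[r])))

    module NotVectorSpace (vs : EAIsVectorSpace K A) (pr : Prime p) (0<a : 0 < a)
                          (p∉A[p^a] : ¬ A (p ^ a) p) where
      h : ℕ → Carrier
      h n = 𝟙 (p ∣? n) +ᴷ (- 1#) *ᴷ 𝟙 (p ^ a ∣? n)

      h∈𝓔 : InEA K A h
      h∈𝓔 = let _ , add , scale = vs in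
        add _ _ (p , prime⇒0<p pr , 𝟙[r∣-]-even (prime⇒0<p pr) (p∈A[p] pr))
          (scale (- 1#) _ (p ^ a , prime⇒0<p^e pr a , 𝟙[r∣-]-even (prime⇒0<p^e pr a) (p^a∈A[p^a] pr 0<a)))

      h-off : ¬ p ∣ n → h n ≈ 0#
      h-off {n} p∤n rewrite 𝟙-no (p ∣? n) p∤n | 𝟙-no (p ^ a ∣? n) (p∤n ∘ ∣-trans (m∣m^n p 0<a)) =
        K.trans (K.+-congˡ (K.zeroʳ (- 1#))) (K.+-identityʳ 0#)

      h-on : p ∣ n → ¬ p ^ a ∣ n → h n ≈ 1#
      h-on {n} p∣n p^a∤n rewrite 𝟙-yes (p ∣? n) p∣n | 𝟙-no (p ^ a ∣? n) p^a∤n =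
        K.trans (K.+-congˡ (K.zeroʳ (- 1#))) (K.+-identityʳ 1#)

      h-top : p ^ a ∣ n → h n ≈ 0#
      h-top {n} p^a∣n rewrite 𝟙-yes (p ∣? n) (∣-trans (m∣m^n p 0<a) p^a∣n) | 𝟙-yes (p ^ a ∣? n) p^a∣n =
        K.trans (K.+-congˡ (K.*-identityʳ (- 1#))) (K.-‿inverseʳ 1#)

      p^a∤p^b : b < a → ¬ p ^ a ∣ p ^ b
      p^a∤p^b b<a p^a∣p^b = <⇒≱ b<a (^-cancelʳ-∣ (prime⇒1<p pr) p^a∣p^b)

      1<a : 1 < a
      1<a = ≤∧≢⇒< 0<a λ 1≡a →
        p∉A[p^a] (subst (λ x → A (p ^ x) p) 1≡a (subst (λ x → A x p) (sym (^-identityʳ p)) (p∈A[p] pr)))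

      p∉A[r]⇒¬even : 0 < r → AEven K A r h → ¬ A r p → ⊥
      p∉A[r]⇒¬even {r} 0<r even p∉A[r] = 0≉1 (begin
        0#    ≈⟨ h-off (prime⇒∤1 pr) ⟨
        h 1   ≈⟨ even p 1 (prime⇒0<p pr) [p,r]≡1 ⟨
        h p   ≈⟨ h-on ∣-refl (p^a∤p^b 1<a ∘ subst (p ^ a ∣_) (sym (^-identityʳ p))) ⟩
        1#    ∎)
        where
          [p,r]≡1 : IsAGcd A p r 1
          [p,r]≡1 = 1∣ p , 1∈A[n] 0<r , λ e e∣p e∈A[r] →
            [ ≤-reflexive , (λ { refl → contradiction e∈A[r] p∉A[r] }) ] (prime⇒irreducible pr e∣p)

      p^b∈A[r]⇒¬even : 0 < p ^ b * m → ¬ p ∣ m → 0 < b → b < a → ¬ AEven K A (p ^ b * m) h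
      p^b∈A[r]⇒¬even {b} {m} 0<r p∤m 0<b b<a even = 0≉1 (begin
        0#        ≈⟨ h-top ∣-refl ⟨
        h (p ^ a) ≈⟨ even (p ^ a) (p ^ b) (prime⇒0<p^e pr a) [p^a,r]≡p^b ⟩
        h (p ^ b) ≈⟨ h-on (m∣m^n p 0<b) (p^a∤p^b b<a) ⟩
        1#        ∎)
        where
          p^a⊥m : Coprime (p ^ a) m
          p^a⊥m = coprime-^ˡ (prime∤⇒coprime pr p∤m) a
          p^b-max : ∀ e → e ∣ p ^ a → A (p ^ b * m) e → e ≤ p ^ b
          p^b-max e e∣p^a e∈A[r] = ∣⇒≤ {{>-nonZero (prime⇒0<p^e pr b)}}
            (coprime-divisor (λ (x∣e , x∣m) → p^a⊥m (∣-trans x∣e e∣p^a , x∣m))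
              (subst (e ∣_) (*-comm (p ^ b) m) (subset _ e 0<r e∈A[r])))
          [p^a,r]≡p^b : IsAGcd A (p ^ a) (p ^ b * m) (p ^ b)
          [p^a,r]≡p^b = ^-monoʳ-∣ p (<⇒≤ b<a) ,
                        p^e∈A[p^e*m] pr p∤m 0<b (d∣n⇒0<d 0<r (n∣m*n (p ^ b))) , p^b-max

      absurd : ⊥
      absurd with h∈𝓔
      ... | r , 0<r , even with prime-split pr 0<r
      ... | zero , m , refl , p∤m =
        p∉A[r]⇒¬even 0<r even λ p∈A[r] → p∤m (subst (p ∣_) (*-identityˡ m) (subset _ p 0<r p∈A[r]))
      ... | b@(suc _) , m , refl , p∤m with primePower-dichotomy pr b
      ...   | inj₂ p∉A[p^b] =
        p∉A[r]⇒¬even 0<r even (p∉A[p^b] ∘ p∈A[p^e*m]⇒p∈A[p^e] {e = b} pr p∤m (d∣n⇒0<d 0<r (n∣m*n (p ^ b))))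
      ...   | inj₁ p^k∈A[p^i] with a ≤? b
      ...     | yes a≤b = p∉A[p^a] (subst (A (p ^ a)) (^-identityʳ p) (p^k∈A[p^i] 0<a a≤b))
      ...     | no a≰b = p^b∈A[r]⇒¬even 0<r p∤m z<s (≰⇒> a≰b) even

    vectorSpace⇒p^k∈A[p^a] : EAIsVectorSpace K A → Prime p → 0 < a → ∀ {k} → k ≤ a → A (p ^ a) (p ^ k)
    vectorSpace⇒p^k∈A[p^a] vs pr 0<a k≤a =
      [ (λ p^k∈A[p^i] → p^k∈A[p^i] k≤a ≤-refl) , (⊥-elim ∘ NotVectorSpace.absurd vs pr 0<a) ]
        (primePower-dichotomy pr _)

    vectorSpace⇒allDivisors : EAIsVectorSpace K A → IsAllDivisors A
    vectorSpace⇒allDivisors vs n d 0<n = mk⇔ (subset n d 0<n) (primePower-induction Q Q[1] Q-step n 0<n d)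
      where
        Q : ℕ → Set
        Q n = ∀ d → d ∣ n → A n d
        Q[1] : Q 1
        Q[1] d d∣1 = subst (A 1) (sym (∣1⇒≡1 d∣1)) 1∈A[1]
        Q-step : Prime p → 0 < e → 0 < m → ¬ p ∣ m → Q m → Q (p ^ e * m)
        Q-step {p} {e} {m} pr 0<e 0<m p∤m Q[m] d d∣p^em
          with prime-split pr (d∣n⇒0<d (*-mono-< (prime⇒0<p^e pr e) 0<m) d∣p^em)
        ... | k , d′ , refl , p∤d′ =
          let k≤e , d′∣m = p^k*d∣p^e*m⇒k≤e×d∣m {k = k} pr p∤m p∤d′ d∣p^em
          in A-*-primePower {e = e} pr p∤m 0<m (vectorSpace⇒p^k∈A[p^a] vs pr 0<e k≤e) (Q[m] d′ d′∣m)

  module _ {A : DivSystem} (A=D : IsAllDivisors A) where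
    open Equivalence using (to; from)

    gcd-isAGcd : 0 < n → 0 < r → IsAGcd A n r (gcd n r)
    gcd-isAGcd {n} {r} 0<n 0<r = gcd[m,n]∣m n r , from (A=D r _ 0<r) (gcd[m,n]∣n n r) ,
      λ e e∣n e∈A[r] → ∣⇒≤ {{>-nonZero (d∣n⇒0<d 0<n (gcd[m,n]∣m n r))}}
        (gcd-greatest e∣n (to (A=D r e 0<r) e∈A[r]))

    AEven-∣ : ∀ {f} → 0 < r → r ∣ R → 0 < R → AEven K A r f → AEven K A R f
    AEven-∣ {r} {R} {f} 0<r r∣R 0<R even n d 0<n [n,R]≡d = begin
      f n                 ≈⟨ even n _ 0<n (gcd-isAGcd 0<n 0<r) ⟩
      f (gcd n r)         ≡⟨ cong f (gcd[gcd[n,m],d]≡gcd[n,d] {n = n} r∣R) ⟨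
      f (gcd (gcd n R) r) ≈⟨ even (gcd n R) _ 0<g (gcd-isAGcd 0<g 0<r) ⟨
      f (gcd n R)         ≡⟨ cong f (IsAGcd-unique {A = A} (gcd-isAGcd 0<n 0<R) [n,R]≡d) ⟩
      f d                 ∎
      where 0<g = d∣n⇒0<d 0<n (gcd[m,n]∣m n R)

    allDivisors⇒vectorSpace : EAIsVectorSpace K A
    allDivisors⇒vectorSpace =
      (1 , z<s , λ _ _ _ _ → K.refl) ,
      (λ f g (r , 0<r , f-even) (s , 0<s , g-even) → let 0<rs = *-mono-< 0<r 0<s in
        r * s , 0<rs , λ n d 0<n [n,rs]≡d →
          K.+-cong (AEven-∣ 0<r (m∣m*n s) 0<rs f-even n d 0<n [n,rs]≡d)
                   (AEven-∣ 0<s (n∣m*n r) 0<rs g-even n d 0<n [n,rs]≡d)) ,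
      λ a f (r , 0<r , f-even) → r , 0<r , λ n d 0<n [n,r]≡d → K.*-congˡ (f-even n d 0<n [n,r]≡d)

proposition4 : ∀ {c ℓ : Level} (K : Field c ℓ) (A : DivSystem) → IsRegular A →
                 (EAIsVectorSpace K A ⇔ IsAllDivisors A)
proposition4 K A reg = mk⇔ (vectorSpace⇒allDivisors K reg) (allDivisors⇒vectorSpace K)
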